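{- Let $(f_n)_{n}$ be a family where $f_n$ is an $n$-variate polynomial of degree $\mathrm{poly}(n)$ which has a constant-free arithmetic circuit of size $\mathrm{poly}(n)$. Then $f_n$ has a constant-free almost-MD arithmetic circuit of size $\mathrm{poly}(n)$.
   Context: An arithmetic circuit is a directed acyclic graph whose input nodes are labeled by variables or field constants and whose internal gates compute sums or products of their children; it is constant-free if the only constants used as inputs are $0, 1, -1$. A gate $v$ is constant producing (CP) if in the subcircuit rooted at $v$ all input nodes are field constants. An almost-MD circuit is a circuit in which every multiplication gate either multiplies two disjoint subcircuits, or at least one of its children is constant producing. -}

module Defs where

open import Level using (Level; _⊔_)
open import Algebra.Bundles using (CommutativeRing)
open import Data.Nat using (ℕ; zero; suc; _∸_; _≤_; _>_)
open import Data.Nat as ℕ using ()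
import Data.Nat.Properties as ℕP
open import Data.Fin using (Fin; zero; suc)
open import Data.Vec using (Vec; []; _∷_; replicate)
open import Data.Vec.Properties using (≡-dec)
open import Data.List using (List; []; _∷_; upTo; concatMap; map; foldr)
open import Data.Product using (Σ; ∃; ∃-syntax; _×_; _,_)
open import Data.Sum using (_⊎_)
open import Data.Unit using (⊤)
open import Data.Empty using (⊥)
open import Relation.Nullary using (¬_; yes; no)
open import Relation.Binary.PropositionalEquality using (_≡_)

record Field (c ℓ : Level) : Set (Level.suc (c ⊔ ℓ)) where
  field
    commRing    : CommutativeRing c ℓ
  open CommutativeRing commRing public
  field
    1≉0         : ¬ (1# ≈ 0#)
    inverse     : ∀ x → ¬ (x ≈ 0#) → ∃[ y ] (x * y ≈ 1#)

Monomial : ℕ → Set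
Monomial n = Vec ℕ n

totalDeg : ∀ {n} → Monomial n → ℕ
totalDeg []       = 0
totalDeg (e ∷ es) = e ℕ.+ totalDeg es

splits : ∀ {n} → Monomial n → List (Monomial n × Monomial n)
splits []       = ([] , []) ∷ []
splits (e ∷ es) =
  concatMap (λ i → map (λ { (a , b) → (i ∷ a , (e ∸ i) ∷ b) }) (splits es))
            (upTo (suc e))

unitMon : ∀ {n} → Fin n → Monomial n
unitMon {suc n} zero    = 1 ∷ replicate n 0
unitMon {suc n} (suc j) = 0 ∷ unitMon j

-- Polynomials over a field F in n variables, given by their coefficient
-- functions (finite support is automatic for circuit-computed ones).

module Poly {c ℓ} (F : Field c ℓ) where
  open Field F

  Pol : ℕ → Set c
  Pol n = Monomial n → Carrier

  _≋_ : ∀ {n} → Pol n → Pol n → Set ℓ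
  f ≋ g = ∀ e → f e ≈ g e

  zeroP oneP negOneP : ∀ {n} → Pol n
  zeroP   e = 0#
  oneP    e with ≡-dec ℕP._≟_ e (replicate _ 0)
  ... | yes _ = 1#
  ... | no  _ = 0#
  negOneP e = - (oneP e)

  varP : ∀ {n} → Fin n → Pol n
  varP j e with ≡-dec ℕP._≟_ e (unitMon j)
  ... | yes _ = 1#
  ... | no  _ = 0#

  addP : ∀ {n} → Pol n → Pol n → Pol n
  addP f g e = f e + g e

  mulP : ∀ {n} → Pol n → Pol n → Pol n
  mulP f g e = foldr (λ { (a , b) acc → f a * g b + acc }) 0# (splits e)

  DegLe : ∀ {n} → Pol n → ℕ → Set ℓ
  DegLe f d = ∀ e → totalDeg e > d → f e ≈ 0#

-- A circuit with k nodes is a snoc-list of nodes; node index zero is the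
-- most recently added node, and a node added to a circuit with k nodes
-- may only refer to those k earlier nodes (so the graph is acyclic).

data Gate (n k : ℕ) : Set where
  var        : Fin n → Gate n k
  const0     : Gate n k
  const1     : Gate n k
  constNeg1  : Gate n k
  add        : Fin k → Fin k → Gate n k
  mul        : Fin k → Fin k → Gate n k

infixl 5 _▷_
data Circ (n : ℕ) : ℕ → Set where
  []  : Circ n 0
  _▷_ : ∀ {k} → Circ n k → Gate n k → Circ n (suc k)

data InSub {n : ℕ} : ∀ {k} → Circ n k → Fin k → Fin k → Set where
  here   : ∀ {k} {C : Circ n k} {v} → InSub C v v
  addL   : ∀ {k} {C : Circ n k} {a b u} → InSub C a u → InSub (C ▷ add a b) zero (suc u)
  addR   : ∀ {k} {C : Circ n k} {a b u} → InSub C b u → InSub (C ▷ add a b) zero (suc u)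
  mulL   : ∀ {k} {C : Circ n k} {a b u} → InSub C a u → InSub (C ▷ mul a b) zero (suc u)
  mulR   : ∀ {k} {C : Circ n k} {a b u} → InSub C b u → InSub (C ▷ mul a b) zero (suc u)
  older  : ∀ {k} {C : Circ n k} {g v u} → InSub C v u → InSub (C ▷ g) (suc v) (suc u)

IsVarInput : ∀ {n k} → Circ n k → Fin k → Set
IsVarInput (C ▷ var x) zero    = ⊤
IsVarInput (C ▷ _)     zero    = ⊥
IsVarInput (C ▷ _)     (suc u) = IsVarInput C u

ConstProducing : ∀ {n k} → Circ n k → Fin k → Set
ConstProducing C v = ∀ u → InSub C v u → ¬ IsVarInput C u

DisjointSub : ∀ {n k} → Circ n k → Fin k → Fin k → Set
DisjointSub C a b = ∀ u → InSub C a u → InSub C b u → ⊥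

AlmostMD : ∀ {n k} → Circ n k → Set
AlmostMD []            = ⊤
AlmostMD (C ▷ mul a b) =
  AlmostMD C × (DisjointSub C a b ⊎ (ConstProducing C a ⊎ ConstProducing C b))
AlmostMD (C ▷ _)       = AlmostMD C

module Semantics {c ℓ} (F : Field c ℓ) where
  open Poly F

  eval : ∀ {n k} → Circ n k → Fin k → Pol n
  eval (C ▷ var x)     zero    = varP x
  eval (C ▷ const0)    zero    = zeroP
  eval (C ▷ const1)    zero    = oneP
  eval (C ▷ constNeg1) zero    = negOneP
  eval (C ▷ add a b)   zero    = addP (eval C a) (eval C b)
  eval (C ▷ mul a b)   zero    = mulP (eval C a) (eval C b)
  eval (C ▷ _)         (suc u) = eval C u

  Computes : ∀ {n s} → Circ n s → Fin s → Pol n → Set ℓ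
  Computes C o f = eval C o ≋ f

  HasCircuitOfSize : ∀ {n} → Pol n → ℕ → Set ℓ
  HasCircuitOfSize {n} f m =
    Σ ℕ λ s → Σ (Circ n s) λ C → Σ (Fin s) λ o → s ≤ m × Computes C o f

  HasAlmostMDCircuitOfSize : ∀ {n} → Pol n → ℕ → Set ℓ
  HasAlmostMDCircuitOfSize {n} f m =
    Σ ℕ λ s → Σ (Circ n s) λ C → Σ (Fin s) λ o →
      s ≤ m × AlmostMD C × Computes C o f

module Submission where

-- Let f have degree ≤ D and a constant-free circuit C with m nodes.  For every
-- node v of C, degree i and "position" t with t + i ≤ D we build a node computing
-- the degree-i homogeneous component of the polynomial at v, by the rules
--   component i (A + B) = component i A + component i B,
--   component i (A · B) = Σ_{j ≤ i} component j A · component (i - j) B,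
-- while an input is homogeneous, so each of its components is the input or 0.
-- Every new node carries a label: the interval [t, t + max 1 i) and the degree
-- bound i.  Labels shrink towards the inputs, and in every product either a factor
-- has degree bound 0 (then no variable lies below it: it is constant producing) or
-- the factors have disjoint intervals (then their subcircuits share no node), so
-- the new circuit is almost-MD.  Summing the output's components of degree ≤ D
-- gives f with m (D+1)² (2D+3) + D + 2 gates, a polynomial in n.

open import Defs
open import Level using (_⊔_)
open import Data.Nat using (ℕ; zero; suc; _+_; _*_; _∸_; _^_; _≤_; _<_; z≤n; s≤s)
import Data.Nat.Properties as ℕP
open import Data.Fin using (Fin; zero; suc)
open import Data.Vec using ([]; _∷_; replicate)
open import Data.Vec.Properties using (≡-dec)
open import Data.List using (List; []; _∷_; map; length; upTo; foldr; cartesianProduct)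
open import Data.List.Properties using (length-++; length-map; length-upTo)
open import Data.List.Membership.Propositional using (_∈_; find)
open import Data.List.Membership.Propositional.Properties
  using (∈-concatMap⁻; ∈-map⁻; ∈-upTo⁻; ∈-upTo⁺; ∈-cartesianProduct⁺)
open import Data.List.Relation.Unary.Any using (here; there)
open import Data.Product using (Σ; ∃-syntax; _×_; _,_; proj₁; proj₂)
open import Data.Sum using (_⊎_; inj₁; inj₂)
open import Data.Unit using (⊤; tt)
open import Data.Empty using (⊥-elim)
open import Function using (_∘_)
open import Relation.Nullary using (¬_; Dec; yes; no; _×-dec_)
open import Relation.Binary.PropositionalEquality as ≡ using (_≡_; _≢_; refl; cong; cong₂)
open import Algebra.Properties.CommutativeSemigroup ℕP.+-commutativeSemigroup
  using () renaming (interchange to +-interchange)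

totalDeg-replicate0 : ∀ n → totalDeg (replicate n 0) ≡ 0
totalDeg-replicate0 zero    = refl
totalDeg-replicate0 (suc n) = totalDeg-replicate0 n

totalDeg-unitMon : ∀ {n} (j : Fin n) → totalDeg (unitMon j) ≡ 1
totalDeg-unitMon {suc n} zero    = cong suc (totalDeg-replicate0 n)
totalDeg-unitMon {suc n} (suc j) = totalDeg-unitMon j

splits-totalDeg : ∀ {n} (e : Monomial n) {a b} → (a , b) ∈ splits e →
                  totalDeg a + totalDeg b ≡ totalDeg e
splits-totalDeg []       (here refl) = refl
splits-totalDeg (e ∷ es) ab∈
  with i , i∈ , ab∈ᵢ ← find (∈-concatMap⁻ _ {xs = upTo (suc e)} ab∈)
  with (a , b) , ab∈′ , refl ← ∈-map⁻ _ ab∈ᵢ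
  = ≡.trans (+-interchange i (totalDeg a) (e ∸ i) (totalDeg b))
            (cong₂ _+_ (ℕP.m+[n∸m]≡n (ℕP.≤-pred (∈-upTo⁻ i∈))) (splits-totalDeg es ab∈′))

module HomogeneousComponents {c ℓ} (F : Field c ℓ) where
  open Field F
    using (Carrier; _≈_; 0#; -_; setoid; +-cong; *-cong; +-identityˡ; +-identityʳ;
           -‿inverseˡ; -‿cong; zeroˡ; zeroʳ; +-commutativeSemigroup)
    renaming (_+_ to _⊕_; _*_ to _⊗_; refl to ≈-refl; sym to ≈-sym; trans to ≈-trans)
  open Poly F
  open import Relation.Binary.Reasoning.Setoid setoid
  open import Algebra.Properties.CommutativeSemigroup +-commutativeSemigroup
    using () renaming (interchange to ⊕-interchange)

  keepIf : ∀ {p} {P : Set p} → Dec P → Carrier → Carrier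
  keepIf (yes _) x = x
  keepIf (no _)  x = 0#

  keepIf-yes : ∀ {p} {P : Set p} → P → (d : Dec P) (x : Carrier) → keepIf d x ≈ x
  keepIf-yes p (yes _) x = ≈-refl
  keepIf-yes p (no ¬p) x = ⊥-elim (¬p p)

  keepIf-no : ∀ {p} {P : Set p} → ¬ P → (d : Dec P) (x : Carrier) → keepIf d x ≈ 0#
  keepIf-no ¬p (yes p) x = ⊥-elim (¬p p)
  keepIf-no ¬p (no _)  x = ≈-refl

  keepIf-⇔ : ∀ {p q} {P : Set p} {Q : Set q} → (P → Q) → (Q → P) →
             (d : Dec P) (d′ : Dec Q) (x : Carrier) → keepIf d x ≈ keepIf d′ x
  keepIf-⇔ to from (yes p) d′ x = ≈-sym (keepIf-yes (to p) d′ x)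
  keepIf-⇔ to from (no ¬p) d′ x = ≈-sym (keepIf-no (¬p ∘ from) d′ x)

  keepIf-cong : ∀ {p} {P : Set p} (d : Dec P) {x y} → x ≈ y → keepIf d x ≈ keepIf d y
  keepIf-cong (yes _) x≈y = x≈y
  keepIf-cong (no _)  x≈y = ≈-refl

  keepIf-+ : ∀ {p} {P : Set p} (d : Dec P) x y → keepIf d (x ⊕ y) ≈ keepIf d x ⊕ keepIf d y
  keepIf-+ (yes _) x y = ≈-refl
  keepIf-+ (no _)  x y = ≈-sym (+-identityˡ 0#)

  keepIf-*ʳ : ∀ {p} {P : Set p} (d : Dec P) x y → x ⊗ keepIf d y ≈ keepIf d (x ⊗ y)
  keepIf-*ʳ (yes _) x y = ≈-refl
  keepIf-*ʳ (no _)  x y = zeroʳ x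

  keepIf-keepIf : ∀ {p q} {P : Set p} {Q : Set q} (d : Dec P) (d′ : Dec Q) x →
                  keepIf d (keepIf d′ x) ≈ keepIf (d ×-dec d′) x
  keepIf-keepIf (yes _) (yes _) x = ≈-refl
  keepIf-keepIf (yes _) (no _)  x = ≈-refl
  keepIf-keepIf (no _)  _       x = ≈-refl

  sumList : ∀ {A : Set} → (A → Carrier) → List A → Carrier
  sumList h []       = 0#
  sumList h (x ∷ xs) = h x ⊕ sumList h xs

  sumBelow : (ℕ → Carrier) → ℕ → Carrier
  sumBelow h zero    = 0#
  sumBelow h (suc m) = sumBelow h m ⊕ h m

  sumList-cong : ∀ {A : Set} (L : List A) {h h′ : A → Carrier} →
                 (∀ x → x ∈ L → h x ≈ h′ x) → sumList h L ≈ sumList h′ L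
  sumList-cong []      eq = ≈-refl
  sumList-cong (x ∷ L) eq = +-cong (eq x (here refl)) (sumList-cong L (λ y → eq y ∘ there))

  sumList-0 : ∀ {A : Set} (L : List A) → sumList (λ _ → 0#) L ≈ 0#
  sumList-0 []      = ≈-refl
  sumList-0 (x ∷ L) = ≈-trans (+-cong ≈-refl (sumList-0 L)) (+-identityˡ 0#)

  sumList-+ : ∀ {A : Set} (L : List A) (h h′ : A → Carrier) →
              sumList (λ x → h x ⊕ h′ x) L ≈ sumList h L ⊕ sumList h′ L
  sumList-+ []      h h′ = ≈-sym (+-identityˡ 0#)
  sumList-+ (x ∷ L) h h′ =
    ≈-trans (+-cong ≈-refl (sumList-+ L h h′)) (⊕-interchange (h x) (h′ x) (sumList h L) (sumList h′ L))

  keepIf-sumList : ∀ {p} {P : Set p} (d : Dec P) {A : Set} (L : List A) h →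
                   sumList (keepIf d ∘ h) L ≈ keepIf d (sumList h L)
  keepIf-sumList (yes _) L h = ≈-refl
  keepIf-sumList (no _)  L h = sumList-0 L

  sumBelow-cong : ∀ {h h′ : ℕ → Carrier} m → (∀ j → h j ≈ h′ j) → sumBelow h m ≈ sumBelow h′ m
  sumBelow-cong zero    eq = ≈-refl
  sumBelow-cong (suc m) eq = +-cong (sumBelow-cong m eq) (eq m)

  sumBelow-sumList : ∀ {A : Set} (L : List A) (h : ℕ → A → Carrier) m →
                     sumBelow (λ j → sumList (h j) L) m ≈ sumList (λ x → sumBelow (λ j → h j x) m) L
  sumBelow-sumList L h zero    = ≈-sym (sumList-0 L)
  sumBelow-sumList L h (suc m) =
    ≈-trans (+-cong (sumBelow-sumList L h m) ≈-refl)
            (≈-sym (sumList-+ L (λ x → sumBelow (λ j → h j x) m) (h m)))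

  sumBelow-single : (j₀ : ℕ) (h : ℕ → Carrier) → (∀ j → j ≢ j₀ → h j ≈ 0#) →
                    ∀ m → sumBelow h m ≈ keepIf (j₀ ℕP.<? m) (h j₀)
  sumBelow-single j₀ h off zero    = ≈-sym (keepIf-no (λ ()) (j₀ ℕP.<? 0) (h j₀))
  sumBelow-single j₀ h off (suc m) with m ℕP.≟ j₀
  ... | yes refl = begin
    sumBelow h m ⊕ h m                 ≈⟨ +-cong (sumBelow-single m h off m) ≈-refl ⟩
    keepIf (m ℕP.<? m) (h m) ⊕ h m     ≈⟨ +-cong (keepIf-no (ℕP.<-irrefl refl) (m ℕP.<? m) (h m)) ≈-refl ⟩
    0# ⊕ h m                           ≈⟨ +-identityˡ (h m) ⟩
    h m                                ≈⟨ ≈-sym (keepIf-yes (ℕP.n<1+n m) (m ℕP.<? suc m) (h m)) ⟩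
    keepIf (m ℕP.<? suc m) (h m)       ∎
  ... | no m≢j₀ = begin
    sumBelow h m ⊕ h m                 ≈⟨ +-cong (sumBelow-single j₀ h off m) (off m m≢j₀) ⟩
    keepIf (j₀ ℕP.<? m) (h j₀) ⊕ 0#    ≈⟨ +-identityʳ (keepIf (j₀ ℕP.<? m) (h j₀)) ⟩
    keepIf (j₀ ℕP.<? m) (h j₀)         ≈⟨ keepIf-⇔ ℕP.m<n⇒m<1+n below (j₀ ℕP.<? m) (j₀ ℕP.<? suc m) (h j₀) ⟩
    keepIf (j₀ ℕP.<? suc m) (h j₀)     ∎
    where
    below : j₀ < suc m → j₀ < m
    below j₀<1+m = ℕP.≤∧≢⇒< (ℕP.≤-pred j₀<1+m) (m≢j₀ ∘ ≡.sym)

  component : ∀ {n} → ℕ → Pol n → Pol n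
  component i f e = keepIf (totalDeg e ℕP.≟ i) (f e)

  Homogeneous : ∀ {n} → ℕ → Pol n → Set ℓ
  Homogeneous δ f = ∀ e → totalDeg e ≢ δ → f e ≈ 0#

  component-homogeneous-same : ∀ {n} δ (f : Pol n) → Homogeneous δ f → component δ f ≋ f
  component-homogeneous-same δ f hom e with totalDeg e ℕP.≟ δ
  ... | yes _  = ≈-refl
  ... | no  ne = ≈-sym (hom e ne)

  component-homogeneous-other : ∀ {n} δ i (f : Pol n) → Homogeneous δ f → i ≢ δ → component i f ≋ zeroP
  component-homogeneous-other δ i f hom i≢δ e with totalDeg e ℕP.≟ i
  ... | yes refl = hom e i≢δ
  ... | no _     = ≈-refl

  homogeneous-zeroP : ∀ {n} δ → Homogeneous {n} δ zeroP
  homogeneous-zeroP δ e _ = ≈-refl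

  homogeneous-oneP : ∀ {n} → Homogeneous {n} 0 oneP
  homogeneous-oneP {n} e deg≢0 with ≡-dec ℕP._≟_ e (replicate n 0)
  ... | yes refl = ⊥-elim (deg≢0 (totalDeg-replicate0 n))
  ... | no _     = ≈-refl

  homogeneous-negOneP : ∀ {n} → Homogeneous {n} 0 negOneP
  homogeneous-negOneP e deg≢0 =
    ≈-trans (-‿cong (homogeneous-oneP e deg≢0)) (≈-trans (≈-sym (+-identityʳ (- 0#))) (-‿inverseˡ 0#))

  homogeneous-varP : ∀ {n} (x : Fin n) → Homogeneous 1 (varP x)
  homogeneous-varP x e deg≢1 with ≡-dec ℕP._≟_ e (unitMon x)
  ... | yes refl = ⊥-elim (deg≢1 (totalDeg-unitMon x))
  ... | no _     = ≈-refl

  component-addP : ∀ {n} i (f g : Pol n) → component i (addP f g) ≋ addP (component i f) (component i g)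
  component-addP i f g e = keepIf-+ (totalDeg e ℕP.≟ i) (f e) (g e)

  mulP-sum : ∀ {n} (f g : Pol n) e → mulP f g e ≈ sumList (λ p → f (proj₁ p) ⊗ g (proj₂ p)) (splits e)
  mulP-sum f g e = go (splits e)
    where
    go : ∀ L → foldr (λ { (a , b) acc → f a ⊗ g b ⊕ acc }) 0# L ≈ sumList (λ p → f (proj₁ p) ⊗ g (proj₂ p)) L
    go []      = ≈-refl
    go (_ ∷ L) = +-cong ≈-refl (go L)

  mulP-cong : ∀ {n} {f f′ g g′ : Pol n} → f ≋ f′ → g ≋ g′ → mulP f g ≋ mulP f′ g′
  mulP-cong {f = f} {f′} {g} {g′} f≋f′ g≋g′ e = begin
    mulP f g e                                           ≈⟨ mulP-sum f g e ⟩
    sumList (λ p → f (proj₁ p) ⊗ g (proj₂ p)) (splits e)   ≈⟨ sumList-cong (splits e) (λ p _ → *-cong (f≋f′ (proj₁ p)) (g≋g′ (proj₂ p))) ⟩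
    sumList (λ p → f′ (proj₁ p) ⊗ g′ (proj₂ p)) (splits e) ≈⟨ ≈-sym (mulP-sum f′ g′ e) ⟩
    mulP f′ g′ e                                         ∎

  -- the degree-i part of one summand f(a) g(b) of a product is the single term
  -- j = deg a of Σ_{j ≤ i} (component j f)(a) (component (i - j) g)(b)
  component-mulP-term : ∀ {n} i (f g : Pol n) e {a b} → (a , b) ∈ splits e →
    keepIf (totalDeg e ℕP.≟ i) (f a ⊗ g b) ≈ sumBelow (λ j → component j f a ⊗ component (i ∸ j) g b) (suc i)
  component-mulP-term i f g e {a} {b} ab∈ = ≈-sym (begin
    sumBelow (λ j → component j f a ⊗ component (i ∸ j) g b) (suc i)
      ≈⟨ sumBelow-single (totalDeg a) _ off (suc i) ⟩
    keepIf (da ℕP.<? suc i) (keepIf (da ℕP.≟ da) (f a) ⊗ keepIf (db ℕP.≟ i ∸ da) (g b))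
      ≈⟨ keepIf-cong (da ℕP.<? suc i) (*-cong (keepIf-yes refl (da ℕP.≟ da) (f a)) ≈-refl) ⟩
    keepIf (da ℕP.<? suc i) (f a ⊗ keepIf (db ℕP.≟ i ∸ da) (g b))
      ≈⟨ keepIf-cong (da ℕP.<? suc i) (keepIf-*ʳ (db ℕP.≟ i ∸ da) (f a) (g b)) ⟩
    keepIf (da ℕP.<? suc i) (keepIf (db ℕP.≟ i ∸ da) (f a ⊗ g b))
      ≈⟨ keepIf-keepIf (da ℕP.<? suc i) (db ℕP.≟ i ∸ da) (f a ⊗ g b) ⟩
    keepIf ((da ℕP.<? suc i) ×-dec (db ℕP.≟ i ∸ da)) (f a ⊗ g b)
      ≈⟨ keepIf-⇔ to from ((da ℕP.<? suc i) ×-dec (db ℕP.≟ i ∸ da)) (totalDeg e ℕP.≟ i) (f a ⊗ g b) ⟩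
    keepIf (totalDeg e ℕP.≟ i) (f a ⊗ g b) ∎)
    where
    da db : ℕ
    da = totalDeg a
    db = totalDeg b
    da+db≡de : da + db ≡ totalDeg e
    da+db≡de = splits-totalDeg e ab∈
    off : ∀ j → j ≢ da → component j f a ⊗ component (i ∸ j) g b ≈ 0#
    off j j≢da = ≈-trans (*-cong (keepIf-no (j≢da ∘ ≡.sym) (da ℕP.≟ j) (f a)) ≈-refl) (zeroˡ _)
    to : da < suc i × db ≡ i ∸ da → totalDeg e ≡ i
    to (da<1+i , db≡i∸da) =
      ≡.trans (≡.sym da+db≡de) (≡.trans (cong (da +_) db≡i∸da) (ℕP.m+[n∸m]≡n (ℕP.≤-pred da<1+i)))
    from : totalDeg e ≡ i → da < suc i × db ≡ i ∸ da
    from refl = s≤s (ℕP.≤-trans (ℕP.m≤m+n da db) (ℕP.≤-reflexive da+db≡de))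
              , ≡.trans (≡.sym (ℕP.m+n∸m≡n da db)) (cong (_∸ da) da+db≡de)

  component-mulP : ∀ {n} i (f g : Pol n) e →
    component i (mulP f g) e ≈ sumBelow (λ j → mulP (component j f) (component (i ∸ j) g) e) (suc i)
  component-mulP i f g e = begin
    keepIf D (mulP f g e)
      ≈⟨ keepIf-cong D (mulP-sum f g e) ⟩
    keepIf D (sumList (λ p → f (proj₁ p) ⊗ g (proj₂ p)) (splits e))
      ≈⟨ ≈-sym (keepIf-sumList D (splits e) (λ p → f (proj₁ p) ⊗ g (proj₂ p))) ⟩
    sumList (λ p → keepIf D (f (proj₁ p) ⊗ g (proj₂ p))) (splits e)
      ≈⟨ sumList-cong (splits e) (λ p → component-mulP-term i f g e) ⟩
    sumList (λ p → sumBelow (λ j → term j p) (suc i)) (splits e)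
      ≈⟨ ≈-sym (sumBelow-sumList (splits e) term (suc i)) ⟩
    sumBelow (λ j → sumList (term j) (splits e)) (suc i)
      ≈⟨ sumBelow-cong (suc i) (λ j → ≈-sym (mulP-sum (component j f) (component (i ∸ j) g) e)) ⟩
    sumBelow (λ j → mulP (component j f) (component (i ∸ j) g) e) (suc i) ∎
    where
    D : Dec (totalDeg e ≡ i)
    D = totalDeg e ℕP.≟ i
    term : ℕ → Monomial _ × Monomial _ → Carrier
    term j p = component j f (proj₁ p) ⊗ component (i ∸ j) g (proj₂ p)

  sum-of-components : ∀ {n} (f : Pol n) D → DegLe f D → ∀ e → sumBelow (λ i → component i f e) (suc D) ≈ f e
  sum-of-components f D deg≤D e =
    ≈-trans (sumBelow-single (totalDeg e) (λ i → component i f e) off (suc D)) inRange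
    where
    off : ∀ i → i ≢ totalDeg e → component i f e ≈ 0#
    off i i≢de = keepIf-no (i≢de ∘ ≡.sym) (totalDeg e ℕP.≟ i) (f e)
    inRange : keepIf (totalDeg e ℕP.<? suc D) (component (totalDeg e) f e) ≈ f e
    inRange with totalDeg e ℕP.<? suc D
    ... | yes _  = keepIf-yes refl (totalDeg e ℕP.≟ totalDeg e) (f e)
    ... | no  de≮ = ≈-sym (deg≤D e (ℕP.≰⇒> (de≮ ∘ s≤s)))

-- Certificates for almost-MD circuits.
-- A label is a nonempty interval [lo, hi) of "positions" and a degree bound.
record Label : Set where
  constructor label
  field
    lo hi deg : ℕ
open Label public

_⊑_ : Label → Label → Set
u ⊑ v = lo v ≤ lo u × hi u ≤ hi v × deg u ≤ deg v

⊑-refl : ∀ u → u ⊑ u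
⊑-refl u = ℕP.≤-refl , ℕP.≤-refl , ℕP.≤-refl

⊑-reflexive : ∀ {u v} → u ≡ v → u ⊑ v
⊑-reflexive {u} refl = ⊑-refl u

⊑-trans : ∀ {u v w} → u ⊑ v → v ⊑ w → u ⊑ w
⊑-trans (lo≥ , hi≤ , deg≤) (lo≥′ , hi≤′ , deg≤′) =
  ℕP.≤-trans lo≥′ lo≥ , ℕP.≤-trans hi≤ hi≤′ , ℕP.≤-trans deg≤ deg≤′

GateRespects : ∀ {n k} → (Fin k → Label) → Gate n k → Label → Set
GateRespects L (var x)   l = 1 ≤ deg l
GateRespects L const0    l = ⊤
GateRespects L const1    l = ⊤
GateRespects L constNeg1 l = ⊤
GateRespects L (add a b) l = L a ⊑ l × L b ⊑ l
GateRespects L (mul a b) l =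
  L a ⊑ l × L b ⊑ l × (deg (L a) ≡ 0 ⊎ deg (L b) ≡ 0 ⊎ hi (L a) ≤ lo (L b))

WellLabelled : ∀ {n k} → Circ n k → (Fin k → Label) → Set
WellLabelled []      L = ⊤
WellLabelled (C ▷ g) L =
  WellLabelled C (L ∘ suc) × lo (L zero) < hi (L zero) × GateRespects (L ∘ suc) g (L zero)

module _ {n : ℕ} where

  label-InSub : ∀ {k} {C : Circ n k} {L v u} → WellLabelled C L → InSub C v u → L u ⊑ L v
  label-InSub {L = L} {u = u} W here = ⊑-refl (L u)
  label-InSub (W , _ , a⊑ , b⊑)     (addL p)  = ⊑-trans (label-InSub W p) a⊑
  label-InSub (W , _ , a⊑ , b⊑)     (addR p)  = ⊑-trans (label-InSub W p) b⊑
  label-InSub (W , _ , a⊑ , b⊑ , _) (mulL p)  = ⊑-trans (label-InSub W p) a⊑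
  label-InSub (W , _ , a⊑ , b⊑ , _) (mulR p)  = ⊑-trans (label-InSub W p) b⊑
  label-InSub (W , _)               (older p) = label-InSub W p

  label-nonempty : ∀ {k} {C : Circ n k} {L} → WellLabelled C L → ∀ u → lo (L u) < hi (L u)
  label-nonempty {C = C ▷ g} (W , ne , _) zero    = ne
  label-nonempty {C = C ▷ g} (W , _)      (suc u) = label-nonempty W u

  label-var : ∀ {k} {C : Circ n k} {L} → WellLabelled C L → ∀ u → IsVarInput C u → 1 ≤ deg (L u)
  label-var {C = C ▷ var x}     (W , _ , ok) zero    _  = ok
  label-var {C = C ▷ const0}    W            zero    ()
  label-var {C = C ▷ const1}    W            zero    ()
  label-var {C = C ▷ constNeg1} W            zero    ()
  label-var {C = C ▷ add a b}   W            zero    ()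
  label-var {C = C ▷ mul a b}   W            zero    ()
  label-var {C = C ▷ var x}     (W , _)      (suc u) iv = label-var W u iv
  label-var {C = C ▷ const0}    (W , _)      (suc u) iv = label-var W u iv
  label-var {C = C ▷ const1}    (W , _)      (suc u) iv = label-var W u iv
  label-var {C = C ▷ constNeg1} (W , _)      (suc u) iv = label-var W u iv
  label-var {C = C ▷ add a b}   (W , _)      (suc u) iv = label-var W u iv
  label-var {C = C ▷ mul a b}   (W , _)      (suc u) iv = label-var W u iv

  deg0⇒ConstProducing : ∀ {k} {C : Circ n k} {L} → WellLabelled C L →
                        ∀ a → deg (L a) ≡ 0 → ConstProducing C a
  deg0⇒ConstProducing {L = L} W a deg≡0 u p iv =
    ℕP.<-irrefl refl (ℕP.≤-trans (label-var W u iv) (ℕP.≤-trans deg≤ (ℕP.≤-reflexive deg≡0)))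
    where
    deg≤ : deg (L u) ≤ deg (L a)
    deg≤ = proj₂ (proj₂ (label-InSub W p))

  -- disjoint intervals force disjoint subcircuits (a shared node would have a
  -- nonempty interval inside both)
  disjoint⇒DisjointSub : ∀ {k} {C : Circ n k} {L} → WellLabelled C L →
                         ∀ a b → hi (L a) ≤ lo (L b) → DisjointSub C a b
  disjoint⇒DisjointSub {L = L} W a b apart u pa pb =
    ℕP.<-irrefl refl (ℕP.≤-trans (ℕP.≤-trans (label-nonempty W u) hi≤) (ℕP.≤-trans apart lo≥))
    where
    hi≤ : hi (L u) ≤ hi (L a)
    hi≤ = proj₁ (proj₂ (label-InSub W pa))
    lo≥ : lo (L b) ≤ lo (L u)
    lo≥ = proj₁ (label-InSub W pb)

  wellLabelled⇒AlmostMD : ∀ {k} {C : Circ n k} {L} → WellLabelled C L → AlmostMD C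
  wellLabelled⇒AlmostMD {C = []}            W = tt
  wellLabelled⇒AlmostMD {C = C ▷ var x}     (W , _) = wellLabelled⇒AlmostMD W
  wellLabelled⇒AlmostMD {C = C ▷ const0}    (W , _) = wellLabelled⇒AlmostMD W
  wellLabelled⇒AlmostMD {C = C ▷ const1}    (W , _) = wellLabelled⇒AlmostMD W
  wellLabelled⇒AlmostMD {C = C ▷ constNeg1} (W , _) = wellLabelled⇒AlmostMD W
  wellLabelled⇒AlmostMD {C = C ▷ add a b}   (W , _) = wellLabelled⇒AlmostMD W
  wellLabelled⇒AlmostMD {C = C ▷ mul a b} (W , _ , _ , _ , inj₁ deg≡0) =
    wellLabelled⇒AlmostMD W , inj₂ (inj₁ (deg0⇒ConstProducing W a deg≡0))
  wellLabelled⇒AlmostMD {C = C ▷ mul a b} (W , _ , _ , _ , inj₂ (inj₁ deg≡0)) =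
    wellLabelled⇒AlmostMD W , inj₂ (inj₂ (deg0⇒ConstProducing W b deg≡0))
  wellLabelled⇒AlmostMD {C = C ▷ mul a b} (W , _ , _ , _ , inj₂ (inj₂ apart)) =
    wellLabelled⇒AlmostMD W , inj₁ (disjoint⇒DisjointSub W a b apart)

width : ℕ → ℕ
width zero    = 1
width (suc m) = suc m

1≤width : ∀ i → 1 ≤ width i
1≤width zero    = s≤s z≤n
1≤width (suc i) = s≤s z≤n

≤width : ∀ i → i ≤ width i
≤width zero    = z≤n
≤width (suc i) = ℕP.≤-refl

width≤1+ : ∀ i → width i ≤ suc i
width≤1+ zero    = ℕP.≤-refl
width≤1+ (suc i) = ℕP.n≤1+n (suc i)

width-mono : ∀ {j i} → j ≤ i → width j ≤ width i
width-mono {zero}  {i}     _   = 1≤width i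
width-mono {suc j} {suc i} j≤i = j≤i

-- The node computing the degree-i component at position t gets the interval
-- [t, t + width i) and degree bound i.
componentLabel : ℕ → ℕ → Label
componentLabel t i = label t (t + width i) i

componentLabel-nonempty : ∀ t i → t < t + width i
componentLabel-nonempty t i = ℕP.≤-trans (ℕP.≤-reflexive (ℕP.+-comm 1 t)) (ℕP.+-monoʳ-≤ t (1≤width i))

-- In the product formula for the component (i, t) the term j multiplies the
-- components (j, t) and (i - j, rightOffset t j (i - j)); the right factor is
-- placed just after the interval of the left one unless it has degree 0.
rightOffset : ℕ → ℕ → ℕ → ℕ
rightOffset t j zero    = t
rightOffset t j (suc _) = t + j

-- the right factor ends where the whole interval ends
offset-sum : ∀ t {j i} → j ≤ i → t + j + (i ∸ j) ≡ t + i
offset-sum t {j} {i} j≤i = ≡.trans (ℕP.+-assoc t j (i ∸ j)) (cong (t +_) (ℕP.m+[n∸m]≡n j≤i))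

leftFactor⊑ : ∀ t {j i} → j ≤ i → componentLabel t j ⊑ componentLabel t i
leftFactor⊑ t j≤i = ℕP.≤-refl , ℕP.+-monoʳ-≤ t (width-mono j≤i) , j≤i

rightFactor⊑ : ∀ t {j i} → j ≤ i → componentLabel (rightOffset t j (i ∸ j)) (i ∸ j) ⊑ componentLabel t i
rightFactor⊑ t {j} {i} j≤i with i ∸ j in eq
... | zero  = ℕP.≤-refl , ℕP.+-monoʳ-≤ t (1≤width i) , z≤n
... | suc r = ℕP.m≤m+n t j , hi≤ , ≡.subst (_≤ i) eq (ℕP.m∸n≤m i j)
  where
  hi≤ : t + j + suc r ≤ t + width i
  hi≤ = ℕP.≤-trans (ℕP.≤-reflexive (≡.trans (cong (t + j +_) (≡.sym eq)) (offset-sum t j≤i)))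
                   (ℕP.+-monoʳ-≤ t (≤width i))

factors-separated : ∀ t j i →
  let l = componentLabel t j ; r = componentLabel (rightOffset t j (i ∸ j)) (i ∸ j)
  in deg l ≡ 0 ⊎ deg r ≡ 0 ⊎ hi l ≤ lo r
factors-separated t zero    i = inj₁ refl
factors-separated t (suc j) i with i ∸ suc j
... | zero  = inj₂ (inj₁ refl)
... | suc r = inj₂ (inj₂ ℕP.≤-refl)

leftFactor-inRange : ∀ {t j i D} → j ≤ i → t + i ≤ D → t + j ≤ D
leftFactor-inRange {t} j≤i t+i≤D = ℕP.≤-trans (ℕP.+-monoʳ-≤ t j≤i) t+i≤D

rightFactor-inRange : ∀ t {j i D} → j ≤ i → t + i ≤ D → rightOffset t j (i ∸ j) + (i ∸ j) ≤ D
rightFactor-inRange t {j} {i} j≤i t+i≤D with i ∸ j in eq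
... | zero  = ℕP.≤-trans (ℕP.≤-reflexive (ℕP.+-identityʳ t)) (ℕP.m+n≤o⇒m≤o t t+i≤D)
... | suc r = ℕP.≤-trans (ℕP.≤-reflexive (≡.trans (cong (t + j +_) (≡.sym eq)) (offset-sum t j≤i))) t+i≤D

length-cartesianProduct : ∀ {A B : Set} (xs : List A) (ys : List B) →
                          length (cartesianProduct xs ys) ≡ length xs * length ys
length-cartesianProduct []       ys = refl
length-cartesianProduct (x ∷ xs) ys =
  ≡.trans (length-++ (map (x ,_) ys)) (cong₂ _+_ (length-map (x ,_) ys) (length-cartesianProduct xs ys))

-- all (degree, position) pairs with both coordinates at most D
positions : ℕ → List (ℕ × ℕ)
positions D = cartesianProduct (upTo (suc D)) (upTo (suc D))

length-positions : ∀ D → length (positions D) ≡ suc D * suc D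
length-positions D =
  ≡.trans (length-cartesianProduct (upTo (suc D)) (upTo (suc D))) (cong₂ _*_ (length-upTo (suc D)) (length-upTo (suc D)))

inRange∈positions : ∀ {D i t} → t + i ≤ D → (i , t) ∈ positions D
inRange∈positions {D} {i} {t} t+i≤D =
  ∈-cartesianProduct⁺ (∈-upTo⁺ (s≤s (ℕP.m+n≤o⇒n≤o t t+i≤D))) (∈-upTo⁺ (s≤s (ℕP.m+n≤o⇒m≤o t t+i≤D)))

module Homogenisation {c ℓ} (F : Field c ℓ) (D n : ℕ) where
  open Field F using (_≈_; +-cong) renaming (refl to ≈-refl; sym to ≈-sym; trans to ≈-trans)
  open Poly F
  open Semantics F
  open HomogeneousComponents F

  record LabelledCircuit : Set where
    field
      {size}       : ℕ
      circ         : Circ n size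
      labels       : Fin size → Label
      wellLabelled : WellLabelled circ labels
  open LabelledCircuit

  emptyCircuit : LabelledCircuit
  emptyCircuit = record { circ = [] ; labels = λ () ; wellLabelled = tt }

  append : (s : LabelledCircuit) (g : Gate n (size s)) (l : Label) →
           lo l < hi l → GateRespects (labels s) g l → LabelledCircuit
  append s g l nonempty respects = record
    { circ         = circ s ▷ g
    ; labels       = λ { zero → l ; (suc u) → labels s u }
    ; wellLabelled = wellLabelled s , nonempty , respects }

  record _≼_ (s s′ : LabelledCircuit) : Set c where
    field
      embed       : Fin (size s) → Fin (size s′)
      embed-label : ∀ u → labels s′ (embed u) ≡ labels s u
      embed-eval  : ∀ u → eval (circ s′) (embed u) ≡ eval (circ s) u
  open _≼_

  ≼-refl : ∀ {s} → s ≼ s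
  ≼-refl = record { embed = λ u → u ; embed-label = λ _ → refl ; embed-eval = λ _ → refl }

  ≼-trans : ∀ {s₁ s₂ s₃} → s₁ ≼ s₂ → s₂ ≼ s₃ → s₁ ≼ s₃
  ≼-trans ρ ρ′ = record
    { embed       = embed ρ′ ∘ embed ρ
    ; embed-label = λ u → ≡.trans (embed-label ρ′ (embed ρ u)) (embed-label ρ u)
    ; embed-eval  = λ u → ≡.trans (embed-eval ρ′ (embed ρ u)) (embed-eval ρ u) }

  eval-older : ∀ {k} (C : Circ n k) g u → eval (C ▷ g) (suc u) ≡ eval C u
  eval-older C (var x)   u = refl
  eval-older C const0    u = refl
  eval-older C const1    u = refl
  eval-older C constNeg1 u = refl
  eval-older C (add a b) u = refl
  eval-older C (mul a b) u = refl

  ≼-append : ∀ s g l nonempty respects → s ≼ append s g l nonempty respects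
  ≼-append s g l _ _ = record { embed = suc ; embed-label = λ _ → refl ; embed-eval = eval-older (circ s) g }

  record Extension {p} (s : LabelledCircuit) (k : ℕ) (P : LabelledCircuit → Set p) : Set (c ⊔ p) where
    constructor extension
    field
      {result} : LabelledCircuit
      extends  : s ≼ result
      growth   : size result ≤ size s + k
      property : P result

  mapExtension : ∀ {p q} {s k k′} {P : LabelledCircuit → Set p} {Q : LabelledCircuit → Set q} →
                 k ≤ k′ → (∀ {s′} → s ≼ s′ → P s′ → Q s′) → Extension s k P → Extension s k′ Q
  mapExtension k≤k′ f (extension ρ growth p) =
    extension ρ (ℕP.≤-trans growth (ℕP.+-monoʳ-≤ _ k≤k′)) (f ρ p)

  bindExtension : ∀ {p q} {s k k′} {P : LabelledCircuit → Set p} {Q : LabelledCircuit → Set q} →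
                  Extension s k P → (∀ {s′} → s ≼ s′ → P s′ → Extension s′ k′ Q) → Extension s (k + k′) Q
  bindExtension {s = s} {k} {k′} (extension ρ growth p) next with next ρ p
  ... | extension ρ′ growth′ q =
    extension (≼-trans ρ ρ′)
              (ℕP.≤-trans growth′ (ℕP.≤-trans (ℕP.+-monoˡ-≤ k′ growth) (ℕP.≤-reflexive (ℕP.+-assoc (size s) k k′))))
              q

  NodeFor : LabelledCircuit → Label → Pol n → Set ℓ
  NodeFor s l p = Σ (Fin (size s)) λ u → labels s u ≡ l × eval (circ s) u ≋ p

  appendNode : ∀ s g l nonempty respects {p} → eval (circ s ▷ g) zero ≋ p → Extension s 1 (λ s′ → NodeFor s′ l p)
  appendNode s g l nonempty respects computes =
    extension (≼-append s g l nonempty respects) (ℕP.≤-reflexive (ℕP.+-comm 1 (size s))) (zero , refl , computes)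

  NodeFor-≼ : ∀ {s s′ l p} → s ≼ s′ → NodeFor s l p → NodeFor s′ l p
  NodeFor-≼ ρ (u , lab , computes) =
    embed ρ u , ≡.trans (embed-label ρ u) lab , λ e → ≡.subst (λ q → q e ≈ _) (≡.sym (embed-eval ρ u)) (computes e)

  sumChain : ∀ s l → lo l < hi l → (term : ℕ → Pol n) (k m : ℕ) →
             (∀ j → j < m → ∀ {s′} → s ≼ s′ →
                Extension s′ k (λ s″ → Σ (Fin (size s″)) λ u → labels s″ u ⊑ l × eval (circ s″) u ≋ term j)) →
             Extension s (suc (m * suc k)) (λ s′ → NodeFor s′ l (λ e → sumBelow (λ j → term j e) m))
  sumChain s l nonempty term k zero    _    = appendNode s const0 l nonempty tt (λ _ → ≈-refl)
  sumChain s l nonempty term k (suc m) make =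
    mapExtension (ℕP.≤-reflexive cost) (λ _ r → r)
      (bindExtension (sumChain s l nonempty term k m (λ j → make j ∘ ℕP.m<n⇒m<1+n)) λ ρ₁ partial →
        bindExtension (make m (ℕP.n<1+n m) ρ₁) λ {s₂} ρ₂ (v , v⊑l , v-computes) →
          let (u , u-lab , u-computes) = NodeFor-≼ ρ₂ partial in
          appendNode s₂ (add u v) l nonempty (⊑-reflexive u-lab , v⊑l)
                     (λ e → +-cong (u-computes e) (v-computes e)))
    where
    cost : suc (m * suc k) + (k + 1) ≡ suc (suc m * suc k)
    cost = cong suc (≡.trans (ℕP.+-comm (m * suc k) (k + 1)) (cong (_+ m * suc k) (ℕP.+-comm k 1)))

  Components : LabelledCircuit → Pol n → Set ℓ
  Components s Q = ∀ i t → t + i ≤ D → NodeFor s (componentLabel t i) (component i Q)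

  Components-≼ : ∀ {s s′ Q} → s ≼ s′ → Components s Q → Components s′ Q
  Components-≼ ρ comps i t inRange = NodeFor-≼ ρ (comps i t inRange)

  -- gates spent on one component: enough for the product chain
  budget : ℕ
  budget = suc (suc D * 2)

  NewComponent : LabelledCircuit → Pol n → ℕ → ℕ → Set (c ⊔ ℓ)
  NewComponent s Q i t = Extension s budget (λ s′ → NodeFor s′ (componentLabel t i) (component i Q))

  appendComponent : ∀ s g {Q} i t → GateRespects (labels s) g (componentLabel t i) →
                    eval (circ s ▷ g) zero ≋ component i Q → NewComponent s Q i t
  appendComponent s g i t respects computes =
    mapExtension (s≤s z≤n) (λ _ r → r) (appendNode s g (componentLabel t i) (componentLabel-nonempty t i) respects computes)

  inputComponent : ∀ s g {Q} δ → Homogeneous δ Q → eval (circ s ▷ g) zero ≋ Q →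
                   (∀ t → GateRespects (labels s) g (componentLabel t δ)) → ∀ i t → NewComponent s Q i t
  inputComponent s g {Q} δ hom computes respects i t with i ℕP.≟ δ
  ... | yes refl = appendComponent s g i t (respects t)
                     (λ e → ≈-trans (computes e) (≈-sym (component-homogeneous-same δ Q hom e)))
  ... | no i≢δ   = appendComponent s const0 i t tt
                     (λ e → ≈-sym (component-homogeneous-other δ i Q hom i≢δ e))

  addComponent : ∀ s {A B} → Components s A → Components s B → ∀ i t → t + i ≤ D → NewComponent s (addP A B) i t
  addComponent s {A} {B} compsA compsB i t inRange
    with a , a-lab , a-computes ← compsA i t inRange
       | b , b-lab , b-computes ← compsB i t inRange
    = appendComponent s (add a b) i t (⊑-reflexive a-lab , ⊑-reflexive b-lab)
        (λ e → ≈-trans (+-cong (a-computes e) (b-computes e)) (≈-sym (component-addP i A B e)))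

  factorsRespect : ∀ t {j i} → j ≤ i → ∀ {x y} →
                   x ≡ componentLabel t j → y ≡ componentLabel (rightOffset t j (i ∸ j)) (i ∸ j) →
                   x ⊑ componentLabel t i × y ⊑ componentLabel t i × (deg x ≡ 0 ⊎ deg y ≡ 0 ⊎ hi x ≤ lo y)
  factorsRespect t {j} {i} j≤i refl refl =
    leftFactor⊑ t j≤i , rightFactor⊑ t j≤i , factors-separated t j i

  mulComponent : ∀ s {A B} → Components s A → Components s B → ∀ i t → t + i ≤ D → NewComponent s (mulP A B) i t
  mulComponent s {A} {B} compsA compsB i t inRange =
    mapExtension cost (λ _ (u , u-lab , u-computes) → u , u-lab , λ e → ≈-trans (u-computes e) (≈-sym (component-mulP i A B e)))
      (sumChain s (componentLabel t i) (componentLabel-nonempty t i)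
                (λ j → mulP (component j A) (component (i ∸ j) B)) 1 (suc i) (λ j → term ∘ ℕP.≤-pred))
    where
    term : ∀ {j} → j ≤ i → ∀ {s′} → s ≼ s′ →
           Extension s′ 1 (λ s″ → Σ (Fin (size s″)) λ u →
             labels s″ u ⊑ componentLabel t i × eval (circ s″) u ≋ mulP (component j A) (component (i ∸ j) B))
    term {j} j≤i {s′} ρ
      with a , a-lab , a-computes ← Components-≼ ρ compsA j t (leftFactor-inRange j≤i inRange)
         | b , b-lab , b-computes ← Components-≼ ρ compsB (i ∸ j) (rightOffset t j (i ∸ j)) (rightFactor-inRange t j≤i inRange)
      = mapExtension ℕP.≤-refl (λ _ (u , u-lab , u-computes) → u , ⊑-reflexive u-lab , u-computes)
          (appendNode s′ (mul a b) (componentLabel t i) (componentLabel-nonempty t i)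
                      (factorsRespect t j≤i a-lab b-lab) (mulP-cong a-computes b-computes))
    cost : suc (suc i * 2) ≤ budget
    cost = s≤s (ℕP.*-monoˡ-≤ 2 (s≤s (ℕP.m+n≤o⇒n≤o t inRange)))

  gateComponent : ∀ {m} {C : Circ n m} (g : Gate n m) s → (∀ v → Components s (eval C v)) →
                  ∀ i t → t + i ≤ D → NewComponent s (eval (C ▷ g) zero) i t
  gateComponent (var x)   s _     i t _ =
    inputComponent s (var x) 1 (homogeneous-varP x) (λ _ → ≈-refl) (λ _ → s≤s z≤n) i t
  gateComponent const0    s _     i t _ =
    inputComponent s const0 0 (homogeneous-zeroP 0) (λ _ → ≈-refl) (λ _ → tt) i t
  gateComponent const1    s _     i t _ =
    inputComponent s const1 0 homogeneous-oneP (λ _ → ≈-refl) (λ _ → tt) i t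
  gateComponent constNeg1 s _     i t _ =
    inputComponent s constNeg1 0 homogeneous-negOneP (λ _ → ≈-refl) (λ _ → tt) i t
  gateComponent (add a b) s comps = addComponent s (comps a) (comps b)
  gateComponent (mul a b) s comps = mulComponent s (comps a) (comps b)

  ComponentsAt : LabelledCircuit → Pol n → List (ℕ × ℕ) → Set ℓ
  ComponentsAt s Q ps = ∀ i t → (i , t) ∈ ps → t + i ≤ D → NodeFor s (componentLabel t i) (component i Q)

  addComponents : ∀ s {Q} → (∀ {s′} → s ≼ s′ → ∀ i t → t + i ≤ D → NewComponent s′ Q i t) →
                  ∀ ps → Extension s (length ps * budget) (λ s′ → ComponentsAt s′ Q ps)
  addComponents s new []                = extension ≼-refl (ℕP.m≤m+n (size s) 0) (λ _ _ ())
  addComponents s {Q} new ((i₀ , t₀) ∷ ps) =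
    mapExtension (ℕP.≤-reflexive (ℕP.+-comm (length ps * budget) budget)) (λ _ r → r)
      (bindExtension (addComponents s new ps) next)
    where
    next : ∀ {s₁} → s ≼ s₁ → ComponentsAt s₁ Q ps →
           Extension s₁ budget (λ s′ → ComponentsAt s′ Q ((i₀ , t₀) ∷ ps))
    next {s₁} ρ₁ old with t₀ + i₀ ℕP.≤? D
    ... | no  out = extension ≼-refl (ℕP.m≤m+n (size s₁) budget) λ where
          i t (here refl) inRange → ⊥-elim (out inRange)
          i t (there p)   inRange → old i t p inRange
    ... | yes inRange₀ = mapExtension ℕP.≤-refl extend (new ρ₁ i₀ t₀ inRange₀)
      where
      extend : ∀ {s′} → s₁ ≼ s′ → NodeFor s′ (componentLabel t₀ i₀) (component i₀ Q) → ComponentsAt s′ Q ((i₀ , t₀) ∷ ps)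
      extend ρ node i t (here refl) _       = node
      extend ρ node i t (there p)   inRange = NodeFor-≼ ρ (old i t p inRange)

  nodeCost : ℕ
  nodeCost = suc D * suc D * budget

  homogenise : ∀ {m} (C : Circ n m) → Extension emptyCircuit (m * nodeCost) (λ s → ∀ v → Components s (eval C v))
  homogenise []      = extension ≼-refl z≤n (λ ())
  homogenise {suc m} (C ▷ g) =
    mapExtension (ℕP.≤-reflexive cost) (λ _ r → r)
      (bindExtension (homogenise C) λ {s} _ comps →
         mapExtension ℕP.≤-refl (λ ρ new → all ρ comps new)
           (addComponents s (λ ρ → gateComponent g _ (λ v → Components-≼ ρ (comps v))) (positions D)))
    where
    cost : m * nodeCost + length (positions D) * budget ≡ suc m * nodeCost
    cost = ≡.trans (cong (λ l → m * nodeCost + l * budget) (length-positions D)) (ℕP.+-comm (m * nodeCost) nodeCost)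
    all : ∀ {s s′} → s ≼ s′ → (∀ v → Components s (eval C v)) → ComponentsAt s′ (eval (C ▷ g) zero) (positions D) →
          ∀ v → Components s′ (eval (C ▷ g) v)
    all ρ comps new zero    i t inRange = new i t (inRange∈positions inRange) inRange
    all ρ comps new (suc v) rewrite eval-older C g v = Components-≼ ρ (comps v)

  outputLabel : Label
  outputLabel = label 0 (suc D) D

  component⊑output : ∀ {i} → i ≤ D → componentLabel 0 i ⊑ outputLabel
  component⊑output {i} i≤D = z≤n , ℕP.≤-trans (width≤1+ i) (s≤s i≤D) , i≤D

  homogeneousSum : ∀ {m} (C : Circ n m) o →
                   Extension emptyCircuit (m * nodeCost + suc (suc D * 1))
                     (λ s → NodeFor s outputLabel (λ e → sumBelow (λ i → component i (eval C o) e) (suc D)))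
  homogeneousSum C o =
    bindExtension (homogenise C) λ {s} _ comps →
      sumChain s outputLabel (s≤s z≤n) (λ i → component i (eval C o)) 0 (suc D) λ i i<1+D ρ →
        let (v , v-lab , v-computes) = Components-≼ ρ (comps o) i 0 (ℕP.≤-pred i<1+D) in
        extension ≼-refl (ℕP.m≤m+n _ 0)
          (v , ≡.subst (_⊑ outputLabel) (≡.sym v-lab) (component⊑output (ℕP.≤-pred i<1+D)) , v-computes)

  almostMD-circuit : (f : Pol n) → DegLe f D → ∀ m → HasCircuitOfSize f m →
                     HasAlmostMDCircuitOfSize f (m * nodeCost + suc (suc D * 1))
  almostMD-circuit f deg≤D m (m₀ , C , o , m₀≤m , computes)
    with extension {s} _ growth (u , _ , u-computes) ← homogeneousSum C o
    = size s , circ s , u , size-bound , wellLabelled⇒AlmostMD (wellLabelled s) , λ e →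
        ≈-trans (u-computes e)
          (≈-trans (sumBelow-cong (suc D) (λ i → keepIf-cong (totalDeg e ℕP.≟ i) (computes e)))
                   (sum-of-components f D deg≤D e))
    where
    size-bound : size s ≤ m * nodeCost + suc (suc D * 1)
    size-bound = ℕP.≤-trans growth (ℕP.+-monoˡ-≤ (suc (suc D * 1)) (ℕP.*-monoˡ-≤ nodeCost m₀≤m))

PolyBounded : (ℕ → ℕ) → Set
PolyBounded x = ∃[ a ] (∀ n → x n ≤ (2 + n) ^ a)

m≤[2+n]^m : ∀ m n → m ≤ (2 + n) ^ m
m≤[2+n]^m zero    n = z≤n
m≤[2+n]^m (suc m) n =
  ℕP.≤-trans (ℕP.+-mono-≤ (ℕP.m^n>0 (2 + n) m) (m≤[2+n]^m m n))
             (ℕP.+-monoʳ-≤ ((2 + n) ^ m) (ℕP.m≤m+n ((2 + n) ^ m) _))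

bounded-const : ∀ c → PolyBounded (λ _ → c)
bounded-const c = c , m≤[2+n]^m c

bounded-power : ∀ k → PolyBounded (λ n → n ^ k)
bounded-power k = k , λ n → ℕP.^-monoˡ-≤ k (ℕP.m≤n+m n 2)

bounded-+ : ∀ {x y} → PolyBounded x → PolyBounded y → PolyBounded (λ n → x n + y n)
bounded-+ (a , x≤) (b , y≤) = suc (a + b) , λ n →
  ℕP.≤-trans (ℕP.+-mono-≤ (ℕP.≤-trans (x≤ n) (ℕP.^-monoʳ-≤ (2 + n) (ℕP.m≤m+n a b)))
                          (ℕP.≤-trans (y≤ n) (ℕP.^-monoʳ-≤ (2 + n) (ℕP.m≤n+m b a))))
             (ℕP.+-monoʳ-≤ ((2 + n) ^ (a + b)) (ℕP.m≤m+n _ _))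

bounded-* : ∀ {x y} → PolyBounded x → PolyBounded y → PolyBounded (λ n → x n * y n)
bounded-* (a , x≤) (b , y≤) = a + b , λ n →
  ℕP.≤-trans (ℕP.*-mono-≤ (x≤ n) (y≤ n)) (ℕP.≤-reflexive (≡.sym (ℕP.^-distribˡ-+-* (2 + n) a b)))

-- back to the shape n ^ k + k of the statement
exponentOf : ℕ → ℕ
exponentOf a = 2 * a + 3 ^ a

-- for n ≥ 2, (2 + n) ^ a ≤ (n ^ 2) ^ a; for n ≤ 1 the constant 3 ^ a suffices
2+n≤n^2 : ∀ n → 2 ≤ n → 2 + n ≤ n ^ 2
2+n≤n^2 (suc zero) (s≤s ())
2+n≤n^2 n@(suc (suc n′)) 2≤n =
  ℕP.≤-trans (ℕP.+-monoˡ-≤ n 2≤n)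
             (ℕP.≤-trans (ℕP.+-monoʳ-≤ n (ℕP.m≤m+n n (n′ * n)))
                         (ℕP.≤-reflexive (cong (n *_) (≡.sym (ℕP.*-identityʳ n)))))

[2+n]^a≤ : ∀ a n → (2 + n) ^ a ≤ n ^ exponentOf a + exponentOf a
[2+n]^a≤ a zero = ℕP.≤-trans (ℕP.^-monoˡ-≤ a (s≤s (s≤s z≤n)))
                             (ℕP.≤-trans (ℕP.m≤n+m (3 ^ a) (2 * a)) (ℕP.m≤n+m _ (0 ^ exponentOf a)))
[2+n]^a≤ a (suc zero) = ℕP.≤-trans (ℕP.m≤n+m (3 ^ a) (2 * a)) (ℕP.m≤n+m _ (1 ^ exponentOf a))
[2+n]^a≤ a n@(suc (suc _)) = begin
  (2 + n) ^ a                      ≤⟨ ℕP.^-monoˡ-≤ a (2+n≤n^2 n (s≤s (s≤s z≤n))) ⟩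
  (n ^ 2) ^ a                      ≡⟨ ℕP.^-*-assoc n 2 a ⟩
  n ^ (2 * a)                      ≤⟨ ℕP.^-monoʳ-≤ n (ℕP.m≤m+n (2 * a) (3 ^ a)) ⟩
  n ^ exponentOf a                 ≤⟨ ℕP.m≤m+n _ (exponentOf a) ⟩
  n ^ exponentOf a + exponentOf a  ∎
  where open ℕP.≤-Reasoning

toStatementBound : ∀ {x} → PolyBounded x → ∃[ k ] (∀ n → x n ≤ n ^ k + k)
toStatementBound (a , x≤) = exponentOf a , λ n → ℕP.≤-trans (x≤ n) ([2+n]^a≤ a n)

HasAlmostMD-mono : ∀ {c ℓ} (F : Field c ℓ) {n} {f : Poly.Pol F n} {m m′} → m ≤ m′ →
                   Semantics.HasAlmostMDCircuitOfSize F f m → Semantics.HasAlmostMDCircuitOfSize F f m′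
HasAlmostMD-mono F m≤m′ (s , C , o , s≤m , almostMD , computes) = s , C , o , ℕP.≤-trans s≤m m≤m′ , almostMD , computes

-- The theorem: apply the construction with D = n ^ d + d and m = n ^ k + k, and
-- check that the resulting size m (D+1)² (2D+3) + D + 2 is polynomial in n.
lemma5p2 : ∀ {c ℓ} (F : Field c ℓ) (f : (n : ℕ) → Poly.Pol F n) →
    (∃[ d ] (∀ n → Poly.DegLe F (f n) (n ^ d + d))) →
    (∃[ k ] (∀ n → Semantics.HasCircuitOfSize F (f n) (n ^ k + k))) →
    ∃[ k′ ] (∀ n → Semantics.HasAlmostMDCircuitOfSize F (f n) (n ^ k′ + k′))
lemma5p2 F f (d , deg≤) (k , hasCircuit) =
  let (k′ , size≤) = toStatementBound sizeBound in
  k′ , λ n → HasAlmostMD-mono F (size≤ n)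
               (Homogenisation.almostMD-circuit F (n ^ d + d) n (f n) (deg≤ n) (n ^ k + k) (hasCircuit n))
  where
  1+ : ∀ {x} → PolyBounded x → PolyBounded (λ n → suc (x n))
  1+ = bounded-+ (bounded-const 1)
  degree : PolyBounded (λ n → suc (n ^ d + d))
  degree = 1+ (bounded-+ (bounded-power d) (bounded-const d))
  sizeBound : PolyBounded (λ n → (n ^ k + k) * Homogenisation.nodeCost F (n ^ d + d) n + suc (suc (n ^ d + d) * 1))
  sizeBound = bounded-+ (bounded-* (bounded-+ (bounded-power k) (bounded-const k))
                                   (bounded-* (bounded-* degree degree) (1+ (bounded-* degree (bounded-const 2)))))
                        (1+ (bounded-* degree (bounded-const 1)))
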